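{- Let $P_\infty$ be the two-way infinite path. Then (1) $(P_\infty \,\square\, P_\infty)^{[\natural 2]}$ is isomorphic to $2(P_\infty \boxtimes P_\infty)$, and (2) $(P_\infty \times P_\infty)^{[\natural 2]}$ is isomorphic to $4(P_\infty \boxtimes P_\infty)$.
   Context: $P_\infty$ has vertex set $\mathbb{Z}$ with edges $\{i,i+1\}$, $i\in\mathbb{Z}$. For a graph $G$, $G^{[\natural 2]}$ is the graph on $V(G)$ in which two vertices are adjacent iff their distance in $G$ is exactly $2$. $kG$ denotes the disjoint union of $k$ copies of $G$. Products have vertex set $V(G)\times V(H)$: Cartesian $G\,\square\,H$: $(g_1,h_1)\sim(g_2,h_2)$ iff ($g_1g_2\in E(G)$, $h_1=h_2$) or ($g_1=g_2$, $h_1h_2\in E(H)$); direct $G\times H$: iff $g_1g_2\in E(G)$ and $h_1h_2\in E(H)$; strong $G\boxtimes H$: union of the Cartesian and direct adjacencies. -}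

module Defs where

open import Level using (0ℓ)
open import Data.Nat using (ℕ; zero; suc)
open import Data.Integer using (ℤ; _+_; +_)
open import Data.Fin using (Fin)
open import Data.Product using (_×_; Σ; _,_)
open import Data.Sum using (_⊎_)
open import Relation.Nullary using (¬_)
open import Relation.Binary.PropositionalEquality using (_≡_)
open import Function.Bundles using (_↔_; Inverse)

record Graph : Set₁ where
  field
    V : Set
    E : V → V → Set
open Graph public

P∞ : Graph
V P∞ = ℤ
E P∞ i j = (j ≡ i + + 1) ⊎ (i ≡ j + + 1)

data Walk (G : Graph) : ℕ → V G → V G → Set where
  here : ∀ {u} → Walk G zero u u
  step : ∀ {k u w v} → E G u w → Walk G k w v → Walk G (suc k) u v

Dist2 : (G : Graph) → V G → V G → Set
Dist2 G u v = Walk G 2 u v × ¬ Walk G 0 u v × ¬ Walk G 1 u v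

exact2 : Graph → Graph
V (exact2 G) = V G
E (exact2 G) = Dist2 G

copies : ℕ → Graph → Graph
V (copies k G) = Fin k × V G
E (copies k G) (a , x) (b , y) = (a ≡ b) × E G x y

_□_ : Graph → Graph → Graph
V (G □ H) = V G × V H
E (G □ H) (g₁ , h₁) (g₂ , h₂) = (E G g₁ g₂ × h₁ ≡ h₂) ⊎ (g₁ ≡ g₂ × E H h₁ h₂)

_⊗_ : Graph → Graph → Graph
V (G ⊗ H) = V G × V H
E (G ⊗ H) (g₁ , h₁) (g₂ , h₂) = E G g₁ g₂ × E H h₁ h₂

_⊠_ : Graph → Graph → Graph
V (G ⊠ H) = V G × V H
E (G ⊠ H) x y = E (G □ H) x y ⊎ E (G ⊗ H) x y

_≅_ : Graph → Graph → Set
G ≅ H = Σ (V G ↔ V H) λ f →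
  ∀ x y → (E G x y → E H (Inverse.to f x) (Inverse.to f y))
        × (E H (Inverse.to f x) (Inverse.to f y) → E G x y)

-- P∞ □ P∞, P∞ ⊗ P∞ and P∞ ⊠ P∞ are the Cayley graphs of ℤ² for the rook, bishop and king
-- moves. The exact-distance-2 graph of a Cayley graph is again a Cayley graph: its moves are
-- the sums of two moves that are neither 0 nor a single move (parity excludes the latter).
-- For the rook these are the images of the king moves under (x , y) ↦ (x + y , x − y), for the
-- bishop under (x , y) ↦ (2x , 2y). Both maps embed ℤ² as a sublattice of index 2, resp. 4,
-- and each coset of the sublattice carries one copy of the king graph.

module Submission where

open import Defs
open import Data.Product using (_×_; _,_; proj₁; proj₂; ∃; ∃₂)
open import Data.Product.Properties using (,-injectiveˡ; ,-injectiveʳ)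
open import Data.Sum using (_⊎_; inj₁; inj₂; [_,_])
open import Data.Nat as ℕ using (ℕ)
open import Data.Nat.Divisibility using (divides; ∣1⇒≡1)
open import Data.Integer using (ℤ; +_; 0ℤ; _+_; _-_; -_; _*_; ∣_∣)
open import Data.Integer.Properties
  using (+-identityʳ; +-identityˡ; +-assoc; abs-*; *-cancelʳ-≡; +-0-abelianGroup)
open import Data.Integer.DivMod using (_/ℕ_; n%ℕd<d; a≡a%ℕn+[a/ℕn]*n)
open import Data.Integer.Tactic.RingSolver using (solve-∀)
open import Algebra.Properties.AbelianGroup +-0-abelianGroup using (∙-cancelˡ)
open import Data.Sign using (Sign) renaming (+ to ⁺; - to ⁻)
open import Data.Fin using (Fin; toℕ; fromℕ<)
open import Data.Fin.Patterns using (0F; 1F)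
open import Data.Fin.Properties using (toℕ-fromℕ<; *↔×)
open import Data.Empty using (⊥-elim)
open import Function using (_∘_)
open import Level using (0ℓ)
open import Function.Bundles using (_↔_; Inverse; Injection; mk↔ₛ′)
open import Function.Properties.Inverse using (↔-sym; ↔-refl; ↔⇒↣)
open import Function.Construct.Composition using (_↔-∘_)
open import Data.Product.Algebra using (×-cong; ×-assoc)
open import Relation.Nullary using (¬_; contradiction)
open import Relation.Binary.PropositionalEquality
  using (_≡_; _≢_; refl; sym; trans; cong; cong₂; subst; subst₂; module ≡-Reasoning)

≅-sym : ∀ {G H} → G ≅ H → H ≅ G
≅-sym {G} {H} (f , f-iso) = ↔-sym f , λ x y → reflect x y , preserve x y
  where
  open Inverse f
  reflect : ∀ x y → E H x y → E G (from x) (from y)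
  reflect x y e = proj₂ (f-iso (from x) (from y))
    (subst₂ (E H) (sym (strictlyInverseˡ x)) (sym (strictlyInverseˡ y)) e)
  preserve : ∀ x y → E G (from x) (from y) → E H x y
  preserve x y e = subst₂ (E H) (strictlyInverseˡ x) (strictlyInverseˡ y)
    (proj₁ (f-iso (from x) (from y)) e)

walk₀⇒≡ : ∀ {G u v} → Walk G 0 u v → u ≡ v
walk₀⇒≡ here = refl

walk₁⇒edge : ∀ {G u v} → Walk G 1 u v → E G u v
walk₁⇒edge (step e here) = e

walk₂⇒path : ∀ {G u v} → Walk G 2 u v → ∃ λ w → E G u w × E G w v
walk₂⇒path (step e (step e′ here)) = _ , e , e′

ℤ² : Set
ℤ² = ℤ × ℤ

infixl 6 _+²_
_+²_ : ℤ² → ℤ² → ℤ²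
(x , y) +² (x′ , y′) = (x + x′ , y + y′)

0ℤ² : ℤ²
0ℤ² = (0ℤ , 0ℤ)

+²-assoc : ∀ p q r → p +² q +² r ≡ p +² (q +² r)
+²-assoc (x , y) (x′ , y′) (x″ , y″) = cong₂ _,_ (+-assoc x x′ x″) (+-assoc y y′ y″)

+²-identityʳ : ∀ p → p +² 0ℤ² ≡ p
+²-identityʳ (x , y) = cong₂ _,_ (+-identityʳ x) (+-identityʳ y)

+²-cancelˡ : ∀ p q r → p +² q ≡ p +² r → q ≡ r
+²-cancelˡ (x , y) (x′ , y′) (x″ , y″) eq =
  cong₂ _,_ (∙-cancelˡ x x′ x″ (,-injectiveˡ eq)) (∙-cancelˡ y y′ y″ (,-injectiveʳ eq))

onℤ² : (ℤ² → ℤ² → Set) → Graph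
V (onℤ² _) = ℤ²
E (onℤ² adj) = adj

record IsCayley (adj : ℤ² → ℤ² → Set) {S : Set} (σ : S → ℤ²) : Set where
  field
    move   : ∀ p s → adj p (p +² σ s)
    move⁻¹ : ∀ {p q} → adj p q → ∃ λ s → q ≡ p +² σ s

module _ {adj : ℤ² → ℤ² → Set} {S T : Set} {σ : S → ℤ²} {τ : T → ℤ²}
         (σ-cayley : IsCayley adj σ) where

  open IsCayley σ-cayley

  private
    G : Graph
    G = onℤ² adj

    walk₀⇒≡0 : ∀ {p c} → Walk G 0 p (p +² c) → c ≡ 0ℤ²
    walk₀⇒≡0 {p} {c} w = +²-cancelˡ p c 0ℤ² (trans (sym (walk₀⇒≡ w)) (sym (+²-identityʳ p)))

  exact2-isCayley :
    (∀ s s′ → σ s +² σ s′ ≡ 0ℤ² ⊎ ∃ λ t → σ s +² σ s′ ≡ τ t) →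
    (∀ t → ∃₂ λ s s′ → τ t ≡ σ s +² σ s′) →
    (∀ t → τ t ≢ 0ℤ²) →
    (∀ t s → τ t ≢ σ s) →
    IsCayley (Dist2 G) τ
  exact2-isCayley two-moves τ-split τ≢0 τ≢σ = record { move = τ-move ; move⁻¹ = dist2⇒τ-move }
    where
    dist2⇒τ-move : ∀ {p q} → Dist2 G p q → ∃ λ t → q ≡ p +² τ t
    dist2⇒τ-move {p} (w , ¬w₀ , _) with walk₂⇒path w
    ... | _ , e , e′ with move⁻¹ e | move⁻¹ e′
    ... | s , refl | s′ , refl with two-moves s s′
    ... | inj₁ ≡0 = ⊥-elim (¬w₀ (subst (Walk G 0 p) eq here))
      where
      eq : p ≡ p +² σ s +² σ s′
      eq = sym (trans (+²-assoc p (σ s) (σ s′)) (trans (cong (p +²_) ≡0) (+²-identityʳ p)))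
    ... | inj₂ (t , ≡τ) = t , trans (+²-assoc p (σ s) (σ s′)) (cong (p +²_) ≡τ)

    τ-move : ∀ p t → Dist2 G p (p +² τ t)
    τ-move p t with τ-split t
    ... | s , s′ , τ≡ = walk , τ≢0 t ∘ walk₀⇒≡0 , ¬walk₁
      where
      walk : Walk G 2 p (p +² τ t)
      walk = step (move p s) (step (subst (adj _) eq (move (p +² σ s) s′)) here)
        where
        eq : p +² σ s +² σ s′ ≡ p +² τ t
        eq = trans (+²-assoc p (σ s) (σ s′)) (cong (p +²_) (sym τ≡))
      ¬walk₁ : ¬ Walk G 1 p (p +² τ t)
      ¬walk₁ w with move⁻¹ (walk₁⇒edge w)
      ... | s″ , eq = τ≢σ t s″ (+²-cancelˡ p (τ t) (σ s″) eq)

unit : Sign → ℤ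
unit ⁺ = + 1
unit ⁻ = - + 1

P∞-move : ∀ i s → E P∞ i (i + unit s)
P∞-move i ⁺ = inj₁ refl
P∞-move i ⁻ = inj₂ (x≡x-1+1 i)
  where
  x≡x-1+1 : ∀ x → x ≡ x + - + 1 + + 1
  x≡x-1+1 = solve-∀

P∞-move⁻¹ : ∀ {i j} → E P∞ i j → ∃ λ s → j ≡ i + unit s
P∞-move⁻¹ (inj₁ j≡i+1) = ⁺ , j≡i+1
P∞-move⁻¹ {j = j} (inj₂ refl) = ⁻ , x≡x+1-1 j
  where
  x≡x+1-1 : ∀ x → x ≡ x + + 1 + - + 1
  x≡x+1-1 = solve-∀

RookMove BishopMove KingMove : Set
RookMove = Sign ⊎ Sign
BishopMove = Sign × Sign
KingMove = RookMove ⊎ BishopMove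

rook : RookMove → ℤ²
rook (inj₁ s) = (unit s , 0ℤ)
rook (inj₂ s) = (0ℤ , unit s)

bishop : BishopMove → ℤ²
bishop (s , s′) = (unit s , unit s′)

king : KingMove → ℤ²
king = [ rook , bishop ]

□-isCayley : IsCayley (E (P∞ □ P∞)) rook
□-isCayley = record { move = move ; move⁻¹ = move⁻¹ }
  where
  move : ∀ p d → E (P∞ □ P∞) p (p +² rook d)
  move (x , y) (inj₁ s) = inj₁ (P∞-move x s , sym (+-identityʳ y))
  move (x , y) (inj₂ s) = inj₂ (sym (+-identityʳ x) , P∞-move y s)
  move⁻¹ : ∀ {p q} → E (P∞ □ P∞) p q → ∃ λ d → q ≡ p +² rook d
  move⁻¹ {_ , y} (inj₁ (e , refl)) with P∞-move⁻¹ e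
  ... | s , x′≡ = inj₁ s , cong₂ _,_ x′≡ (sym (+-identityʳ y))
  move⁻¹ {x , _} (inj₂ (refl , e)) with P∞-move⁻¹ e
  ... | s , y′≡ = inj₂ s , cong₂ _,_ (sym (+-identityʳ x)) y′≡

⊗-isCayley : IsCayley (E (P∞ ⊗ P∞)) bishop
⊗-isCayley = record { move = move ; move⁻¹ = move⁻¹ }
  where
  move : ∀ p d → E (P∞ ⊗ P∞) p (p +² bishop d)
  move (x , y) (s , s′) = P∞-move x s , P∞-move y s′
  move⁻¹ : ∀ {p q} → E (P∞ ⊗ P∞) p q → ∃ λ d → q ≡ p +² bishop d
  move⁻¹ (e , e′) with P∞-move⁻¹ e | P∞-move⁻¹ e′
  ... | s , x′≡ | s′ , y′≡ = (s , s′) , cong₂ _,_ x′≡ y′≡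

⊠-isCayley : IsCayley (E (P∞ ⊠ P∞)) king
⊠-isCayley = record { move = move ; move⁻¹ = move⁻¹ }
  where
  move : ∀ p k → E (P∞ ⊠ P∞) p (p +² king k)
  move p (inj₁ d) = inj₁ (IsCayley.move □-isCayley p d)
  move p (inj₂ d) = inj₂ (IsCayley.move ⊗-isCayley p d)
  move⁻¹ : ∀ {p q} → E (P∞ ⊠ P∞) p q → ∃ λ k → q ≡ p +² king k
  move⁻¹ (inj₁ e) with IsCayley.move⁻¹ □-isCayley e
  ... | d , eq = inj₁ d , eq
  move⁻¹ (inj₂ e) with IsCayley.move⁻¹ ⊗-isCayley e
  ... | d , eq = inj₂ d , eq

module _ {adjH adjG : ℤ² → ℤ² → Set} {K : Set} {κ τ : K → ℤ²} {n : ℕ}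
         (κ-cayley : IsCayley adjH κ) (τ-cayley : IsCayley adjG τ)
         (φ : (Fin n × ℤ²) ↔ ℤ²)
         (φ-move : ∀ a u k → Inverse.to φ (a , u +² κ k) ≡ Inverse.to φ (a , u) +² τ k) where

  private
    module κ = IsCayley κ-cayley
    module τ = IsCayley τ-cayley
    open Inverse φ using (to)

  copies≅ : copies n (onℤ² adjH) ≅ onℤ² adjG
  copies≅ = φ , λ x y → preserve x y , reflect x y
    where
    preserve : ∀ x y → E (copies n (onℤ² adjH)) x y → adjG (to x) (to y)
    preserve (a , u) (_ , _) (refl , e) with κ.move⁻¹ e
    ... | k , refl = subst (adjG (to (a , u))) (sym (φ-move a u k)) (τ.move _ k)
    reflect : ∀ x y → adjG (to x) (to y) → E (copies n (onℤ² adjH)) x y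
    reflect (a , u) (b , u′) e with τ.move⁻¹ e
    ... | k , eq with Injection.injective (↔⇒↣ φ) (trans eq (sym (φ-move a u k)))
    ... | refl = refl , κ.move u k

Odd : ℤ → Set
Odd z = ∃ λ m → z ≡ + 1 + m * + 2

unit-odd : ∀ s → Odd (unit s)
unit-odd ⁺ = 0ℤ , refl
unit-odd ⁻ = - + 1 , refl

even-¬odd : ∀ m → ¬ Odd (m * + 2)
even-¬odd m (n , eq) = contradiction (∣1⇒≡1 (divides ∣ m - n ∣ 1≡∣m-n∣*2)) λ ()
  where
  open ≡-Reasoning
  x≡x+y-y : ∀ x y → x ≡ x + y - y
  x≡x+y-y = solve-∀
  *2-distrib-- : ∀ x y → (x - y) * + 2 ≡ x * + 2 - y * + 2
  *2-distrib-- = solve-∀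
  1≡∣m-n∣*2 : 1 ≡ ∣ m - n ∣ ℕ.* 2
  1≡∣m-n∣*2 = begin
    ∣ + 1 ∣                       ≡⟨ cong ∣_∣ (x≡x+y-y (+ 1) (n * + 2)) ⟩
    ∣ + 1 + n * + 2 - n * + 2 ∣   ≡⟨ cong (λ z → ∣ z - n * + 2 ∣) eq ⟨
    ∣ m * + 2 - n * + 2 ∣         ≡⟨ cong ∣_∣ (*2-distrib-- m n) ⟨
    ∣ (m - n) * + 2 ∣             ≡⟨ abs-* (m - n) (+ 2) ⟩
    ∣ m - n ∣ ℕ.* 2               ∎

Fin2×ℤ↔ℤ : (Fin 2 × ℤ) ↔ ℤ
Fin2×ℤ↔ℤ = mk↔ₛ′ to from to∘from (λ t → to-injective (to∘from (to t)))
  where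
  to : Fin 2 × ℤ → ℤ
  to (r , q) = + toℕ r + q * + 2
  from : ℤ → Fin 2 × ℤ
  from x = fromℕ< (n%ℕd<d x 2) , x /ℕ 2
  to∘from : ∀ x → to (from x) ≡ x
  to∘from x = trans (cong (λ r → + r + x /ℕ 2 * + 2) (toℕ-fromℕ< (n%ℕd<d x 2)))
                    (sym (a≡a%ℕn+[a/ℕn]*n x 2))
  to-injective : ∀ {t t′} → to t ≡ to t′ → t ≡ t′
  to-injective {0F , q} {0F , q′} eq = cong (0F ,_) (*-cancelʳ-≡ q q′ (+ 2) (∙-cancelˡ (+ 0) _ _ eq))
  to-injective {1F , q} {1F , q′} eq = cong (1F ,_) (*-cancelʳ-≡ q q′ (+ 2) (∙-cancelˡ (+ 1) _ _ eq))
  to-injective {0F , q} {1F , q′} eq = ⊥-elim (even-¬odd q (q′ , trans (sym (+-identityˡ _)) eq))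
  to-injective {1F , q} {0F , q′} eq = ⊥-elim (even-¬odd q′ (q , trans (sym (+-identityˡ _)) (sym eq)))

Fin2×ℤ↔ℤ-move : ∀ r q w → Inverse.to Fin2×ℤ↔ℤ (r , q + w) ≡ Inverse.to Fin2×ℤ↔ℤ (r , q) + w * + 2
Fin2×ℤ↔ℤ-move r = distrib (+ toℕ r)
  where
  distrib : ∀ x q w → x + (q + w) * + 2 ≡ x + q * + 2 + w * + 2
  distrib = solve-∀

shear↔ : ℤ² ↔ ℤ²
shear↔ = mk↔ₛ′ (λ (x , y) → (x - y , y)) (λ (x , y) → (x + y , y))
  (λ (x , y) → cong (_, y) (x+y-y≡x x y)) (λ (x , y) → cong (_, y) (x-y+y≡x x y))
  where
  x+y-y≡x : ∀ x y → x + y - y ≡ x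
  x+y-y≡x = solve-∀
  x-y+y≡x : ∀ x y → x - y + y ≡ x
  x-y+y≡x = solve-∀

mirror↔ : ℤ² ↔ ℤ²
mirror↔ = mk↔ₛ′ mirror mirror involutive involutive
  where
  mirror : ℤ² → ℤ²
  mirror (x , y) = (x , x - y)
  x-[x-y]≡y : ∀ x y → x - (x - y) ≡ y
  x-[x-y]≡y = solve-∀
  involutive : ∀ p → mirror (mirror p) ≡ p
  involutive (x , y) = cong (x ,_) (x-[x-y]≡y x y)

diag : ℤ² → ℤ²
diag (x , y) = (x + y , x - y)

-- Inverse.to diagonal↔ (a , (u , v)) = (u + v + a , u − v)
diagonal↔ : (Fin 2 × ℤ²) ↔ ℤ²
diagonal↔ = shear↔ ↔-∘ (×-cong Fin2×ℤ↔ℤ ↔-refl ↔-∘ (↔-sym (×-assoc 0ℓ _ _ _) ↔-∘ ×-cong ↔-refl mirror↔))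

diagonal-move : ∀ a u w → Inverse.to diagonal↔ (a , u +² w) ≡ Inverse.to diagonal↔ (a , u) +² diag w
diagonal-move a (x , y) (x′ , y′) = cong₂ _,_
  (trans (cong (_- (x + x′ - (y + y′))) (Fin2×ℤ↔ℤ-move a x x′))
         (shift-fst (Inverse.to Fin2×ℤ↔ℤ (a , x)) x y x′ y′))
  (shift-snd x y x′ y′)
  where
  shift-fst : ∀ z x y x′ y′ → z + x′ * + 2 - (x + x′ - (y + y′)) ≡ z - (x - y) + (x′ + y′)
  shift-fst = solve-∀
  shift-snd : ∀ x y x′ y′ → x + x′ - (y + y′) ≡ x - y + (x′ - y′)
  shift-snd = solve-∀

rook+rook : ∀ d d′ → rook d +² rook d′ ≡ 0ℤ² ⊎ ∃ λ k → rook d +² rook d′ ≡ diag (king k)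
rook+rook (inj₁ ⁺) (inj₁ ⁺) = inj₂ (inj₂ (⁺ , ⁺) , refl)
rook+rook (inj₁ ⁺) (inj₁ ⁻) = inj₁ refl
rook+rook (inj₁ ⁺) (inj₂ ⁺) = inj₂ (inj₁ (inj₁ ⁺) , refl)
rook+rook (inj₁ ⁺) (inj₂ ⁻) = inj₂ (inj₁ (inj₂ ⁺) , refl)
rook+rook (inj₁ ⁻) (inj₁ ⁺) = inj₁ refl
rook+rook (inj₁ ⁻) (inj₁ ⁻) = inj₂ (inj₂ (⁻ , ⁻) , refl)
rook+rook (inj₁ ⁻) (inj₂ ⁺) = inj₂ (inj₁ (inj₂ ⁻) , refl)
rook+rook (inj₁ ⁻) (inj₂ ⁻) = inj₂ (inj₁ (inj₁ ⁻) , refl)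
rook+rook (inj₂ ⁺) (inj₁ ⁺) = inj₂ (inj₁ (inj₁ ⁺) , refl)
rook+rook (inj₂ ⁺) (inj₁ ⁻) = inj₂ (inj₁ (inj₂ ⁻) , refl)
rook+rook (inj₂ ⁺) (inj₂ ⁺) = inj₂ (inj₂ (⁺ , ⁻) , refl)
rook+rook (inj₂ ⁺) (inj₂ ⁻) = inj₁ refl
rook+rook (inj₂ ⁻) (inj₁ ⁺) = inj₂ (inj₁ (inj₂ ⁺) , refl)
rook+rook (inj₂ ⁻) (inj₁ ⁻) = inj₂ (inj₁ (inj₁ ⁻) , refl)
rook+rook (inj₂ ⁻) (inj₂ ⁺) = inj₁ refl
rook+rook (inj₂ ⁻) (inj₂ ⁻) = inj₂ (inj₂ (⁻ , ⁺) , refl)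

diag-king-split : ∀ k → ∃₂ λ d d′ → diag (king k) ≡ rook d +² rook d′
diag-king-split (inj₁ (inj₁ ⁺)) = inj₁ ⁺ , inj₂ ⁺ , refl
diag-king-split (inj₁ (inj₁ ⁻)) = inj₁ ⁻ , inj₂ ⁻ , refl
diag-king-split (inj₁ (inj₂ ⁺)) = inj₁ ⁺ , inj₂ ⁻ , refl
diag-king-split (inj₁ (inj₂ ⁻)) = inj₁ ⁻ , inj₂ ⁺ , refl
diag-king-split (inj₂ (⁺ , ⁺)) = inj₁ ⁺ , inj₁ ⁺ , refl
diag-king-split (inj₂ (⁻ , ⁻)) = inj₁ ⁻ , inj₁ ⁻ , refl
diag-king-split (inj₂ (⁺ , ⁻)) = inj₂ ⁺ , inj₂ ⁺ , refl
diag-king-split (inj₂ (⁻ , ⁺)) = inj₂ ⁻ , inj₂ ⁻ , refl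

diag-king≢0 : ∀ k → diag (king k) ≢ 0ℤ²
diag-king≢0 (inj₁ (inj₁ ⁺)) ()
diag-king≢0 (inj₁ (inj₁ ⁻)) ()
diag-king≢0 (inj₁ (inj₂ ⁺)) ()
diag-king≢0 (inj₁ (inj₂ ⁻)) ()
diag-king≢0 (inj₂ (⁺ , ⁺)) ()
diag-king≢0 (inj₂ (⁻ , ⁻)) ()
diag-king≢0 (inj₂ (⁺ , ⁻)) ()
diag-king≢0 (inj₂ (⁻ , ⁺)) ()

rook-odd-sum : ∀ d → Odd (proj₁ (rook d) + proj₂ (rook d))
rook-odd-sum (inj₁ s) = subst Odd (sym (+-identityʳ (unit s))) (unit-odd s)
rook-odd-sum (inj₂ s) = subst Odd (sym (+-identityˡ (unit s))) (unit-odd s)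

diag≢rook : ∀ w d → diag w ≢ rook d
diag≢rook (x , y) d eq = even-¬odd x (subst Odd (sym x*2≡rook-sum) (rook-odd-sum d))
  where
  x*2≡diag-sum : ∀ x y → x * + 2 ≡ x + y + (x - y)
  x*2≡diag-sum = solve-∀
  x*2≡rook-sum : x * + 2 ≡ proj₁ (rook d) + proj₂ (rook d)
  x*2≡rook-sum = trans (x*2≡diag-sum x y) (cong₂ _+_ (,-injectiveˡ eq) (,-injectiveʳ eq))

×-interchange : ∀ {A B C D : Set} → ((A × B) × (C × D)) ↔ ((A × C) × (B × D))
×-interchange = mk↔ₛ′ swap-middle swap-middle (λ _ → refl) (λ _ → refl)
  where
  swap-middle : ∀ {A B C D : Set} → (A × B) × (C × D) → (A × C) × (B × D)
  swap-middle ((a , b) , (c , d)) = ((a , c) , (b , d))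

double : ℤ² → ℤ²
double (x , y) = (x * + 2 , y * + 2)

-- Inverse.to doubling↔ (a , (u , v)) = (r + 2u , r′ + 2v), where a encodes (r , r′) : Fin 2 × Fin 2
doubling↔ : (Fin 4 × ℤ²) ↔ ℤ²
doubling↔ = ×-cong Fin2×ℤ↔ℤ Fin2×ℤ↔ℤ ↔-∘ (×-interchange ↔-∘ ×-cong (*↔× {2} {2}) ↔-refl)

doubling-move : ∀ a u w → Inverse.to doubling↔ (a , u +² w) ≡ Inverse.to doubling↔ (a , u) +² double w
doubling-move a (x , y) (x′ , y′) =
  cong₂ _,_ (Fin2×ℤ↔ℤ-move _ x x′) (Fin2×ℤ↔ℤ-move _ y y′)

bishop+bishop : ∀ d d′ → bishop d +² bishop d′ ≡ 0ℤ² ⊎ ∃ λ k → bishop d +² bishop d′ ≡ double (king k)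
bishop+bishop (⁺ , ⁺) (⁺ , ⁺) = inj₂ (inj₂ (⁺ , ⁺) , refl)
bishop+bishop (⁺ , ⁺) (⁺ , ⁻) = inj₂ (inj₁ (inj₁ ⁺) , refl)
bishop+bishop (⁺ , ⁺) (⁻ , ⁺) = inj₂ (inj₁ (inj₂ ⁺) , refl)
bishop+bishop (⁺ , ⁺) (⁻ , ⁻) = inj₁ refl
bishop+bishop (⁺ , ⁻) (⁺ , ⁺) = inj₂ (inj₁ (inj₁ ⁺) , refl)
bishop+bishop (⁺ , ⁻) (⁺ , ⁻) = inj₂ (inj₂ (⁺ , ⁻) , refl)
bishop+bishop (⁺ , ⁻) (⁻ , ⁺) = inj₁ refl
bishop+bishop (⁺ , ⁻) (⁻ , ⁻) = inj₂ (inj₁ (inj₂ ⁻) , refl)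
bishop+bishop (⁻ , ⁺) (⁺ , ⁺) = inj₂ (inj₁ (inj₂ ⁺) , refl)
bishop+bishop (⁻ , ⁺) (⁺ , ⁻) = inj₁ refl
bishop+bishop (⁻ , ⁺) (⁻ , ⁺) = inj₂ (inj₂ (⁻ , ⁺) , refl)
bishop+bishop (⁻ , ⁺) (⁻ , ⁻) = inj₂ (inj₁ (inj₁ ⁻) , refl)
bishop+bishop (⁻ , ⁻) (⁺ , ⁺) = inj₁ refl
bishop+bishop (⁻ , ⁻) (⁺ , ⁻) = inj₂ (inj₁ (inj₂ ⁻) , refl)
bishop+bishop (⁻ , ⁻) (⁻ , ⁺) = inj₂ (inj₁ (inj₁ ⁻) , refl)
bishop+bishop (⁻ , ⁻) (⁻ , ⁻) = inj₂ (inj₂ (⁻ , ⁻) , refl)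

double-king-split : ∀ k → ∃₂ λ d d′ → double (king k) ≡ bishop d +² bishop d′
double-king-split (inj₁ (inj₁ ⁺)) = (⁺ , ⁺) , (⁺ , ⁻) , refl
double-king-split (inj₁ (inj₁ ⁻)) = (⁻ , ⁺) , (⁻ , ⁻) , refl
double-king-split (inj₁ (inj₂ ⁺)) = (⁺ , ⁺) , (⁻ , ⁺) , refl
double-king-split (inj₁ (inj₂ ⁻)) = (⁺ , ⁻) , (⁻ , ⁻) , refl
double-king-split (inj₂ (⁺ , ⁺)) = (⁺ , ⁺) , (⁺ , ⁺) , refl
double-king-split (inj₂ (⁻ , ⁻)) = (⁻ , ⁻) , (⁻ , ⁻) , refl
double-king-split (inj₂ (⁺ , ⁻)) = (⁺ , ⁻) , (⁺ , ⁻) , refl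
double-king-split (inj₂ (⁻ , ⁺)) = (⁻ , ⁺) , (⁻ , ⁺) , refl

double-king≢0 : ∀ k → double (king k) ≢ 0ℤ²
double-king≢0 (inj₁ (inj₁ ⁺)) ()
double-king≢0 (inj₁ (inj₁ ⁻)) ()
double-king≢0 (inj₁ (inj₂ ⁺)) ()
double-king≢0 (inj₁ (inj₂ ⁻)) ()
double-king≢0 (inj₂ (⁺ , ⁺)) ()
double-king≢0 (inj₂ (⁻ , ⁻)) ()
double-king≢0 (inj₂ (⁺ , ⁻)) ()
double-king≢0 (inj₂ (⁻ , ⁺)) ()

double≢bishop : ∀ w d → double w ≢ bishop d
double≢bishop (x , _) (s , _) eq = even-¬odd x (subst Odd (sym (,-injectiveˡ eq)) (unit-odd s))

proposition2p6 : (exact2 (P∞ □ P∞) ≅ copies 2 (P∞ ⊠ P∞))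
                 × (exact2 (P∞ ⊗ P∞) ≅ copies 4 (P∞ ⊠ P∞))
proposition2p6 =
  ≅-sym (copies≅ ⊠-isCayley □-exact2-isCayley diagonal↔ (λ a u → diagonal-move a u ∘ king)) ,
  ≅-sym (copies≅ ⊠-isCayley ⊗-exact2-isCayley doubling↔ (λ a u → doubling-move a u ∘ king))
  where
  □-exact2-isCayley : IsCayley (E (exact2 (P∞ □ P∞))) (diag ∘ king)
  □-exact2-isCayley =
    exact2-isCayley □-isCayley rook+rook diag-king-split diag-king≢0 (diag≢rook ∘ king)
  ⊗-exact2-isCayley : IsCayley (E (exact2 (P∞ ⊗ P∞))) (double ∘ king)
  ⊗-exact2-isCayley =
    exact2-isCayley ⊗-isCayley bishop+bishop double-king-split double-king≢0 (double≢bishop ∘ king)
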